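{- For every primed word $w$ (with letters in $\{1'<1<2'<2<\cdots\}$) one has $w\overset{\mathrm{dec}}\sim\mathsf{revrow}(P_{\mathsf{dec}}(w))$.
   Context: Primed numbers: $i':=i-\tfrac12$, ordered $1'<1<2'<2<\cdots$; $\lceil\cdot\rceil$ removes a prime. For strict $\lambda$ the shifted diagram is $\{(i,i+j-1):i\in[\ell(\lambda)],j\in[\lambda_i]\}$; row $i$ = boxes $(i,\cdot)$. A hook word is a sequence of positive integers $w_1\cdots w_k$ with $w_1\ge\dots\ge w_p<w_{p+1}<\dots<w_k$ for some $p\in[k]$; $w_1\cdots w_p$ is its weakly decreasing part, $w_{p+1}\cdots w_k$ its increasing part, $w_p$ its middle element. A decomposition tableau assigns positive integers so that each row $\rho_i$ (left to right) is a hook word and $\rho_i$ is a hook subword of maximal length in $\rho_{i+1}\rho_i$; a primed decomposition tableau adds primes to the middle elements of some subset of rows. $\mathsf{revrow}(T)$ reads row 1 right to left, then row 2 right to left, etc. Decomposition insertion $x\xrightarrow{\mathsf{dec}}T$: at step $i$ a primed number $a_i$ is inserted into row $i$ (possibly empty), starting with $a_1=x$. Put $a=\lceil a_i\rceil$ and remove any prime from the middle element $m_i$ of row $i$ (if nonempty), remembering whether it was primed. If appending $a$ to the row gives a hook word, append it; otherwise $a$ replaces the leftmost entry $b$ of the increasing part with $b\ge a$, and $b$ replaces the leftmost entry $c$ of the weakly decreasing part with $c<b$. Then (1) if row $i$ was empty or the middle position changed: if $a_i$ is primed, prime the new middle element; if a box was appended, halt; else $a_{i+1}=c$ if $m_i$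 was unprimed, $c'$ if primed. (2) Otherwise: if $m_i$ was primed, prime the middle element; if a box was appended, halt; else $a_{i+1}=c$ if $a_i$ is unprimed, $c'$ if primed. For $w=w_m\cdots w_2w_1$, $P_{\mathsf{dec}}(w):=w_m\xrightarrow{\mathsf{dec}}(\cdots(w_1\xrightarrow{\mathsf{dec}}\emptyset)\cdots)$. The relation $\overset{\mathrm{dec}}\sim$ is the smallest equivalence relation on primed words such that $a\sim u$, $b\sim v$ imply $ab\sim uv$ and which contains, for all unprimed positive integers $a,b,c,d$ and all $a^\bullet,a^\circ\in\{a',a\}$, $b^\bullet,b^\circ\in\{b',b\}$, $c^\bullet,c^\circ\in\{c',c\}$ with $a-a^\bullet=b-b^\bullet=c-c^\bullet$ and $a-a^\circ=b-b^\circ=c-c^\circ$: (1) $a^\bullet b\sim a^\bullet b'$ if $a\le b$; (2) $b a^\bullet\sim b'a^\bullet$ if $a<b$; (3) $a^\bullet b d c^\circ\sim a^\bullet d b^\circ c$ if $a\le b\le c<d$; (4) $a^\bullet c d b^\circ\sim a^\bullet c b^\circ d$ if $a\le b<c\le d$; (5) $d a^\bullet c b^\circ\sim a^\bullet d c b^\circ$ if $a\le b<c<d$; (6) $b a^\bullet d c^\circ\sim b^\circ d a^\bullet c$ if $a<b\le c<d$; (7) $c b^\bullet d a^\circ\sim c^\bullet d b a^\circ$ if $a<b<c\le d$; (8) $d b^\bullet c a^\circ\sim b^\bullet d c a^\circ$ if $a<b\le c<d$; (9) $b^\bullet c d a^\circ\sim b^\bullet c a^\circ d$ if $a<b\le c\le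 d$; (10) $c a^\bullet d b^\circ\sim c^\circ d a^\bullet b$ if $a\le b<c\le d$. -}

module Defs where

open import Data.Nat using (ℕ; zero; suc; _≤_; _<_; _≤ᵇ_; _<ᵇ_; _≡ᵇ_; _∸_)
open import Data.Bool using (Bool; true; false; if_then_else_; not; _∧_)
open import Data.List using (List; []; _∷_; [_]; _++_; take; drop; reverse; concatMap; foldr)
open import Data.Maybe using (Maybe; just; nothing)
open import Data.Product using (_×_; _,_)

-- Primed letters.  ⟨ n , false ⟩ is the unprimed number n,
-- ⟨ n , true ⟩ is the primed number n' = n - 1/2.
-- (Positivity of letters is imposed as a hypothesis where needed.)

record Letter : Set where
  constructor ⟨_,_⟩
  field
    val    : ℕ
    primed : Bool
open Letter public

Word : Set
Word = List Letter

decLen : List ℕ → ℕ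
decLen [] = 0
decLen (x ∷ []) = 1
decLen (x ∷ rest@(y ∷ r)) = if y ≤ᵇ x then suc (decLen rest) else 1

strictInc : List ℕ → Bool
strictInc [] = true
strictInc (x ∷ []) = true
strictInc (x ∷ rest@(y ∷ r)) = (x <ᵇ y) ∧ strictInc rest

-- w is a hook word: nonempty, and after its maximal weakly decreasing
-- prefix the remainder is strictly increasing (the middle element is
-- then the last entry of that prefix, at position decLen w).
isHook : List ℕ → Bool
isHook [] = false
isHook w@(_ ∷ _) = strictInc (drop (decLen w) w)

-- Tableaux: a row is its list of (unprimed) entries together with a flag
-- saying whether its middle element is primed.  Row 1 is the head.

Row : Set
Row = List ℕ × Bool

Tableau : Set
Tableau = List Row

replaceFirst : (ℕ → Bool) → ℕ → List ℕ → Maybe (ℕ × List ℕ)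
replaceFirst p x [] = nothing
replaceFirst p x (y ∷ ys) with p y
... | true  = just (y , x ∷ ys)
... | false with replaceFirst p x ys
...   | nothing = nothing
...   | just (z , ys') = just (z , y ∷ ys')

bump : ℕ → List ℕ → Maybe (ℕ × List ℕ)
bump a row with replaceFirst (λ b → a ≤ᵇ b) a (drop (decLen row) row)
... | nothing = nothing
... | just (b , inc') with replaceFirst (λ c → c <ᵇ b) b (take (decLen row) row)
...   | nothing = nothing
...   | just (c , dec') = just (c , dec' ++ inc')

-- decomposition insertion  x →dec T
-- (the 'nothing' branch of bump never occurs for rows that are hook
--  words which are not extendable by a; it is a harmless default)
decInsert : Letter → Tableau → Tableau
decInsert x [] = ([ val x ] , primed x) ∷ []
decInsert x ((row , mp) ∷ rs) with isHook (row ++ [ val x ])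
... | true =
  let row' = row ++ [ val x ]
      changed = not (decLen row' ≡ᵇ decLen row)
  in (row' , (if changed then primed x else mp)) ∷ rs
... | false with bump (val x) row
...   | nothing = (row , mp) ∷ rs
...   | just (c , row') =
  let changed = not (decLen row' ≡ᵇ decLen row)
  in (row' , (if changed then primed x else mp))
       ∷ decInsert ⟨ c , (if changed then mp else primed x) ⟩ rs

Pdec : Word → Tableau
Pdec = foldr decInsert []

rowLetters : Row → Word
rowLetters (row , mp) = go 1 row
  where
    go : ℕ → List ℕ → Word
    go i [] = []
    go i (y ∷ ys) = ⟨ y , mp ∧ (i ≡ᵇ decLen row) ⟩ ∷ go (suc i) ys

revrow : Tableau → Word
revrow = concatMap (λ r → reverse (rowLetters r))

-- In each generator, s encodes the choice of •
-- (x^• = ⟨ x , s ⟩) and t the choice of ∘; unprimed x is ⟨ x , false ⟩,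
-- primed x' is ⟨ x , true ⟩.  Letters are positive integers: 1 ≤ a
-- (a is the smallest of a,b,c,d in every rule).

u : ℕ → Letter
u n = ⟨ n , false ⟩

p : ℕ → Letter
p n = ⟨ n , true ⟩

data DecRel : Word → Word → Set where
  r1  : ∀ {a b s} → 1 ≤ a → a ≤ b →
        DecRel (⟨ a , s ⟩ ∷ u b ∷ []) (⟨ a , s ⟩ ∷ p b ∷ [])
  r2  : ∀ {a b s} → 1 ≤ a → a < b →
        DecRel (u b ∷ ⟨ a , s ⟩ ∷ []) (p b ∷ ⟨ a , s ⟩ ∷ [])
  r3  : ∀ {a b c d s t} → 1 ≤ a → a ≤ b → b ≤ c → c < d →
        DecRel (⟨ a , s ⟩ ∷ u b ∷ u d ∷ ⟨ c , t ⟩ ∷ [])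
               (⟨ a , s ⟩ ∷ u d ∷ ⟨ b , t ⟩ ∷ u c ∷ [])
  r4  : ∀ {a b c d s t} → 1 ≤ a → a ≤ b → b < c → c ≤ d →
        DecRel (⟨ a , s ⟩ ∷ u c ∷ u d ∷ ⟨ b , t ⟩ ∷ [])
               (⟨ a , s ⟩ ∷ u c ∷ ⟨ b , t ⟩ ∷ u d ∷ [])
  r5  : ∀ {a b c d s t} → 1 ≤ a → a ≤ b → b < c → c < d →
        DecRel (u d ∷ ⟨ a , s ⟩ ∷ u c ∷ ⟨ b , t ⟩ ∷ [])
               (⟨ a , s ⟩ ∷ u d ∷ u c ∷ ⟨ b , t ⟩ ∷ [])
  r6  : ∀ {a b c d s t} → 1 ≤ a → a < b → b ≤ c → c < d →
        DecRel (u b ∷ ⟨ a , s ⟩ ∷ u d ∷ ⟨ c , t ⟩ ∷ [])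
               (⟨ b , t ⟩ ∷ u d ∷ ⟨ a , s ⟩ ∷ u c ∷ [])
  r7  : ∀ {a b c d s t} → 1 ≤ a → a < b → b < c → c ≤ d →
        DecRel (u c ∷ ⟨ b , s ⟩ ∷ u d ∷ ⟨ a , t ⟩ ∷ [])
               (⟨ c , s ⟩ ∷ u d ∷ u b ∷ ⟨ a , t ⟩ ∷ [])
  r8  : ∀ {a b c d s t} → 1 ≤ a → a < b → b ≤ c → c < d →
        DecRel (u d ∷ ⟨ b , s ⟩ ∷ u c ∷ ⟨ a , t ⟩ ∷ [])
               (⟨ b , s ⟩ ∷ u d ∷ u c ∷ ⟨ a , t ⟩ ∷ [])
  r9  : ∀ {a b c d s t} → 1 ≤ a → a < b → b ≤ c → c ≤ d →
        DecRel (⟨ b , s ⟩ ∷ u c ∷ u d ∷ ⟨ a , t ⟩ ∷ [])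
               (⟨ b , s ⟩ ∷ u c ∷ ⟨ a , t ⟩ ∷ u d ∷ [])
  r10 : ∀ {a b c d s t} → 1 ≤ a → a ≤ b → b < c → c ≤ d →
        DecRel (u c ∷ ⟨ a , s ⟩ ∷ u d ∷ ⟨ b , t ⟩ ∷ [])
               (⟨ c , t ⟩ ∷ u d ∷ ⟨ a , s ⟩ ∷ u b ∷ [])

infix 4 _~dec_
data _~dec_ : Word → Word → Set where
  gen     : ∀ {x y} → DecRel x y → x ~dec y
  ~refl   : ∀ {x} → x ~dec x
  ~sym    : ∀ {x y} → x ~dec y → y ~dec x
  ~trans  : ∀ {x y z} → x ~dec y → y ~dec z → x ~dec z
  ~concat : ∀ {x y x' y'} → x ~dec x' → y ~dec y' → (x ++ y) ~dec (x' ++ y')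

-- A row is D v I with D ++ [ v ] weakly decreasing and v ∷ I strictly
-- increasing; its reversed reading is I↓ v D↓, the middle letter v carrying
-- the row's prime.  Inserting x into the row prepends x to this reading, and
-- each case of the insertion algorithm is realised by elementary relations.
-- If x is appended, relation (1) or (2) only removes a prime.  Otherwise x
-- bumps the least b ≥ x in I: it commutes past the entries of I beyond b
-- (relations 5, 8) and then past those below x (relation 7), handing its
-- prime to the least of them.  The entry bumped by b is v itself or some c in
-- D; in the latter case b first travels through D up to c (relations 3, 6, 10).
-- Finally the bumped letter sinks to the end of the row's reading (relations
-- 4, 9), where it is exactly the letter inserted into the next row.

module Submission where

open import Defs
open import Data.Nat using (ℕ; zero; suc; _+_; _≤_; _<_; _≥_; _≤ᵇ_; _<ᵇ_; _≡ᵇ_)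
open import Data.Nat.Properties
  using (≤ᵇ⇒≤; ≤⇒≤ᵇ; <ᵇ⇒<; <⇒<ᵇ; ≡ᵇ⇒≡; ≤-trans; <-trans; ≤-<-trans; <-≤-trans; <⇒≤; ≤-refl;
         <⇒≱; >⇒≢; 1+n≢n; m<n⇒m<1+n; n<1+n; m+1+n≢m; ≰⇒>; ≮⇒≥; _≤?_; _<?_; +-suc; +-identityʳ)
open import Data.Bool using (Bool; true; false; not; _∧_; if_then_else_; T)
open import Data.Bool.Properties using (∧-identityʳ; ∧-zeroʳ; ∧-conicalˡ; ∧-conicalʳ; ¬-not; T-≡)
open import Data.List using (List; []; _∷_; [_]; _++_; take; drop; reverse; length; map; head)
open import Data.List.Properties using (++-assoc; ++-identityʳ; reverse-++; unfold-reverse; reverse-map; length-++-sucʳ)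
open import Data.List.Relation.Unary.All as All using (All; []; _∷_)
import Data.List.Relation.Unary.All.Properties as All
open import Data.List.Relation.Unary.AllPairs as AllPairs using ()
open import Data.List.Relation.Unary.Linked as Linked using (Linked; []; [-]; _∷_)
open import Data.List.Relation.Unary.Linked.Properties using (Linked⇒AllPairs)
open import Data.Maybe using (just)
open import Data.Maybe.Relation.Binary.Connected using (Connected; just; just-nothing)
open import Data.Product using (_×_; _,_; proj₁)
open import Data.Empty using (⊥)
open import Function using (flip; _∘_)
open import Function.Bundles using (Equivalence)
open import Level using (0ℓ)
open import Relation.Nullary using (¬_; yes; no)
open import Relation.Binary using (Rel; Transitive; IsEquivalence; Setoid)
import Relation.Binary.Reasoning.Setoid as SetoidReasoning
open import Relation.Binary.PropositionalEquality using (_≡_; refl; sym; trans; cong; cong₂; subst; module ≡-Reasoning)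

¬T⇒≡false : ∀ {b} → ¬ T b → b ≡ false
¬T⇒≡false ¬t = ¬-not (¬t ∘ Equivalence.from T-≡)

≤ᵇ-true : ∀ {m n} → m ≤ n → (m ≤ᵇ n) ≡ true
≤ᵇ-true m≤n = Equivalence.to T-≡ (≤⇒≤ᵇ m≤n)

≤ᵇ-false : ∀ {m n} → n < m → (m ≤ᵇ n) ≡ false
≤ᵇ-false {m} {n} n<m = ¬T⇒≡false (λ t → <⇒≱ n<m (≤ᵇ⇒≤ m n t))

<ᵇ-true : ∀ {m n} → m < n → (m <ᵇ n) ≡ true
<ᵇ-true m<n = Equivalence.to T-≡ (<⇒<ᵇ m<n)

<ᵇ-false : ∀ {m n} → n ≤ m → (m <ᵇ n) ≡ false
<ᵇ-false {m} {n} n≤m = ¬T⇒≡false (λ t → <⇒≱ (<ᵇ⇒< m n t) n≤m)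

≡ᵇ-refl : ∀ n → (n ≡ᵇ n) ≡ true
≡ᵇ-refl zero = refl
≡ᵇ-refl (suc n) = ≡ᵇ-refl n

≡ᵇ-false : ∀ {m n} → ¬ m ≡ n → (m ≡ᵇ n) ≡ false
≡ᵇ-false {m} {n} m≢n = ¬T⇒≡false (λ t → m≢n (≡ᵇ⇒≡ m n t))

All-reverse : ∀ {P : ℕ → Set} xs → All P xs → All P (reverse xs)
All-reverse [] [] = []
All-reverse {P} (x ∷ xs) (px ∷ pxs) =
  subst (All P) (sym (unfold-reverse x xs)) (All.++⁺ (All-reverse xs pxs) (px ∷ []))

≥-trans : Transitive _≥_
≥-trans m≥n n≥o = ≤-trans n≥o m≥n

module _ {R : Rel ℕ 0ℓ} where

  Linked-++⁻ˡ : ∀ xs {ys} → Linked R (xs ++ ys) → Linked R xs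
  Linked-++⁻ˡ [] _ = []
  Linked-++⁻ˡ (x ∷ []) _ = [-]
  Linked-++⁻ˡ (x ∷ y ∷ xs) (r ∷ rs) = r ∷ Linked-++⁻ˡ (y ∷ xs) rs

  Linked-++⁻ʳ : ∀ xs {ys} → Linked R (xs ++ ys) → Linked R ys
  Linked-++⁻ʳ [] rs = rs
  Linked-++⁻ʳ (x ∷ xs) rs = Linked-++⁻ʳ xs (Linked.tail rs)

  Linked-∷ʳ⁺ : ∀ xs {x} → Linked R xs → All (λ z → R z x) xs → Linked R (xs ++ [ x ])
  Linked-∷ʳ⁺ [] _ _ = [-]
  Linked-∷ʳ⁺ (y ∷ []) _ (r ∷ []) = r ∷ [-]
  Linked-∷ʳ⁺ (y ∷ z ∷ xs) (r ∷ rs) (_ ∷ as) = r ∷ Linked-∷ʳ⁺ (z ∷ xs) rs as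

  Linked-∷⁺ : ∀ {x xs} → All (R x) xs → Linked R xs → Linked R (x ∷ xs)
  Linked-∷⁺ [] [] = [-]
  Linked-∷⁺ (r ∷ _) rs = r ∷ rs

  Linked-replace : ∀ xs {c b ys} → Linked R (xs ++ c ∷ ys) → All (λ z → R z b) xs →
                   (∀ {z} → R c z → R b z) → Linked R (xs ++ b ∷ ys)
  Linked-replace [] {ys = []} _ _ _ = [-]
  Linked-replace [] {ys = _ ∷ _} (r ∷ rs) _ f = f r ∷ rs
  Linked-replace (x ∷ []) (r ∷ rs) (rb ∷ []) f = rb ∷ Linked-replace [] rs [] f
  Linked-replace (x ∷ y ∷ xs) (r ∷ rs) (_ ∷ as) f = r ∷ Linked-replace (y ∷ xs) rs as f

  module _ (R-trans : Transitive R) where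

    Linked⇒All-∷ : ∀ {x xs} → Linked R (x ∷ xs) → All (R x) xs
    Linked⇒All-∷ rs = AllPairs.head (Linked⇒AllPairs R-trans rs)

    Linked-last : ∀ {x} xs {y} → Linked R (x ∷ xs ++ [ y ]) → R x y
    Linked-last xs rs = All.head (All.++⁻ʳ xs (Linked⇒All-∷ rs))

    Linked⇒All-∷ʳ : ∀ xs {x} → Linked R (xs ++ [ x ]) → All (λ z → R z x) xs
    Linked⇒All-∷ʳ [] _ = []
    Linked⇒All-∷ʳ (y ∷ xs) rs = Linked-last xs rs ∷ Linked⇒All-∷ʳ xs (Linked.tail rs)

Linked-reverse : ∀ {R : Rel ℕ 0ℓ} → Transitive R → ∀ xs → Linked R xs → Linked (flip R) (reverse xs)
Linked-reverse R-trans [] _ = []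
Linked-reverse {R} R-trans (x ∷ xs) rs =
  subst (Linked (flip R)) (sym (unfold-reverse x xs))
    (Linked-∷ʳ⁺ (reverse xs) (Linked-reverse R-trans xs (Linked.tail rs))
                (All-reverse xs (Linked⇒All-∷ R-trans rs)))

revUnprimed : List ℕ → Word
revUnprimed [] = []
revUnprimed (z ∷ zs) = revUnprimed zs ++ [ u z ]

revUnprimed-++ : ∀ xs ys → revUnprimed (xs ++ ys) ≡ revUnprimed ys ++ revUnprimed xs
revUnprimed-++ [] ys = sym (++-identityʳ (revUnprimed ys))
revUnprimed-++ (x ∷ xs) ys =
  trans (cong (_++ [ u x ]) (revUnprimed-++ xs ys)) (++-assoc (revUnprimed ys) (revUnprimed xs) [ u x ])

revUnprimed-∷ʳ : ∀ xs x → revUnprimed (xs ++ [ x ]) ≡ u x ∷ revUnprimed xs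
revUnprimed-∷ʳ xs x = revUnprimed-++ xs [ x ]

revUnprimed-mid : ∀ xs y ys → revUnprimed (xs ++ y ∷ ys) ≡ revUnprimed ys ++ u y ∷ revUnprimed xs
revUnprimed-mid xs y ys = trans (revUnprimed-++ xs (y ∷ ys)) (++-assoc (revUnprimed ys) [ u y ] (revUnprimed xs))

reverse-map-u : ∀ xs → reverse (map u xs) ≡ revUnprimed xs
reverse-map-u [] = refl
reverse-map-u (x ∷ xs) = trans (unfold-reverse (u x) (map u xs)) (cong (_++ [ u x ]) (reverse-map-u xs))

revUnprimed≡map-reverse : ∀ xs → revUnprimed xs ≡ map u (reverse xs)
revUnprimed≡map-reverse xs = sym (trans (reverse-map u xs) (reverse-map-u xs))

record Hook (D : List ℕ) (v : ℕ) (I : List ℕ) : Set where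
  field
    decreasing : Linked _≥_ (D ++ [ v ])
    increasing : Linked _<_ (v ∷ I)
open Hook

Hook-singleton : ∀ {v} → Hook [] v []
Hook-singleton = record { decreasing = [-] ; increasing = [-] }

if-true : ∀ {A : Set} {b} {x y : A} → b ≡ true → (if b then x else y) ≡ x
if-true refl = refl

decLen-++ : ∀ D {v I} → Linked _≥_ (D ++ [ v ]) → Connected _<_ (just v) (head I) →
            decLen (D ++ v ∷ I) ≡ suc (length D)
decLen-++ [] {I = []} _ _ = refl
decLen-++ [] {I = _ ∷ _} _ (just v<i) rewrite ≤ᵇ-false v<i = refl
decLen-++ (d ∷ []) (v≤d ∷ _) v<I =
  trans (if-true (≤ᵇ-true v≤d)) (cong suc (decLen-++ [] [-] v<I))
decLen-++ (d ∷ d′ ∷ D) (d′≤d ∷ ds) v<I =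
  trans (if-true (≤ᵇ-true d′≤d)) (cong suc (decLen-++ (d′ ∷ D) ds v<I))

decLen-hook : ∀ {D v I} → Hook D v I → decLen (D ++ v ∷ I) ≡ suc (length D)
decLen-hook {D} h = decLen-++ D (decreasing h) (Linked.head′ (increasing h))

take-middle : ∀ (D : List ℕ) v I → take (suc (length D)) (D ++ v ∷ I) ≡ D ++ [ v ]
take-middle [] v I = refl
take-middle (d ∷ D) v I = cong (d ∷_) (take-middle D v I)

drop-middle : ∀ (D : List ℕ) v I → drop (suc (length D)) (D ++ v ∷ I) ≡ I
drop-middle [] v I = refl
drop-middle (d ∷ D) v I = drop-middle D v I

strictInc-true : ∀ {xs} → Linked _<_ xs → strictInc xs ≡ true
strictInc-true [] = refl
strictInc-true [-] = refl
strictInc-true (x<y ∷ rs) rewrite <ᵇ-true x<y = strictInc-true rs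

strictInc⇒Linked : ∀ xs → strictInc xs ≡ true → Linked _<_ xs
strictInc⇒Linked [] _ = []
strictInc⇒Linked (x ∷ []) _ = [-]
strictInc⇒Linked (x ∷ y ∷ xs) e =
  <ᵇ⇒< x y (Equivalence.from T-≡ (∧-conicalˡ _ _ e)) ∷ strictInc⇒Linked (y ∷ xs) (∧-conicalʳ _ _ e)

isHook-++ : ∀ D {v I} → Linked _≥_ (D ++ [ v ]) → Connected _<_ (just v) (head I) →
            isHook (D ++ v ∷ I) ≡ strictInc I
isHook-++ D {v} {I} ds v<I = trans (unfold-isHook D)
  (cong strictInc (trans (cong (λ n → drop n (D ++ v ∷ I)) (decLen-++ D ds v<I)) (drop-middle D v I)))
  where
  unfold-isHook : ∀ D → isHook (D ++ v ∷ I) ≡ strictInc (drop (decLen (D ++ v ∷ I)) (D ++ v ∷ I))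
  unfold-isHook [] = refl
  unfold-isHook (_ ∷ _) = refl

-- The local function of rowLetters, with the middle position n as a parameter.
markFrom : ℕ → Bool → ℕ → List ℕ → Word
markFrom n mp i [] = []
markFrom n mp i (y ∷ ys) = ⟨ y , mp ∧ (i ≡ᵇ n) ⟩ ∷ markFrom n mp (suc i) ys

module _ (n : ℕ) (mp : Bool) (G : ℕ → List ℕ → Word) (G-[] : ∀ i → G i [] ≡ [])
         (G-∷ : ∀ i y ys → G i (y ∷ ys) ≡ ⟨ y , mp ∧ (i ≡ᵇ n) ⟩ ∷ G (suc i) ys) where

  markFrom-unique : ∀ i ys → G i ys ≡ markFrom n mp i ys
  markFrom-unique i [] = G-[] i
  markFrom-unique i (y ∷ ys) = trans (G-∷ i y ys) (cong (_ ∷_) (markFrom-unique (suc i) ys))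

-- That local function cannot be named: it is the metavariable in the type of
-- go≡markFrom, solved at the use below, where abstracting y ∷ ys and 2 makes
-- its occurrence a pattern.
mutual
  private
    go≡markFrom : ∀ row mp i ys → _ ≡ markFrom (decLen row) mp i ys
    go≡markFrom row mp = markFrom-unique (decLen row) mp _ (λ _ → refl) (λ _ _ _ → refl)

  rowLetters≡markFrom : ∀ row mp → rowLetters (row , mp) ≡ markFrom (decLen row) mp 1 row
  rowLetters≡markFrom [] mp = refl
  rowLetters≡markFrom (y ∷ ys) mp with y ∷ ys | 2
  ... | row | i = cong (_ ∷_) (go≡markFrom row mp i ys)

unmarked : ∀ mp {i n} → ¬ i ≡ n → mp ∧ (i ≡ᵇ n) ≡ false
unmarked mp i≢n = trans (cong (mp ∧_) (≡ᵇ-false i≢n)) (∧-zeroʳ mp)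

markFrom-beyond : ∀ {n} mp {i} xs → n < i → markFrom n mp i xs ≡ map u xs
markFrom-beyond mp [] _ = refl
markFrom-beyond mp (x ∷ xs) n<i =
  cong₂ (λ f w → ⟨ x , f ⟩ ∷ w) (unmarked mp (>⇒≢ n<i)) (markFrom-beyond mp xs (m<n⇒m<1+n n<i))

markFrom-middle : ∀ D {v I} mp {i n} → i + length D ≡ n →
                  markFrom n mp i (D ++ v ∷ I) ≡ map u D ++ ⟨ v , mp ⟩ ∷ map u I
markFrom-middle [] {I = I} mp {i} refl rewrite +-identityʳ i | ≡ᵇ-refl i | ∧-identityʳ mp =
  cong (_ ∷_) (markFrom-beyond mp I (n<1+n i))
markFrom-middle (d ∷ D) mp {i} refl =
  cong₂ (λ f w → ⟨ d , f ⟩ ∷ w) (unmarked mp (m+1+n≢m i ∘ sym))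
        (markFrom-middle D mp (sym (+-suc i (length D))))

revRowLetters : Row → Word
revRowLetters r = reverse (rowLetters r)

revRowLetters-hook : ∀ {D v I} mp → Hook D v I →
                     revRowLetters (D ++ v ∷ I , mp) ≡ revUnprimed I ++ ⟨ v , mp ⟩ ∷ revUnprimed D
revRowLetters-hook {D} {v} {I} mp h = begin
  reverse (rowLetters (D ++ v ∷ I , mp))
    ≡⟨ cong reverse (rowLetters≡markFrom (D ++ v ∷ I) mp) ⟩
  reverse (markFrom (decLen (D ++ v ∷ I)) mp 1 (D ++ v ∷ I))
    ≡⟨ cong (λ n → reverse (markFrom n mp 1 (D ++ v ∷ I))) (decLen-hook h) ⟩
  reverse (markFrom (suc (length D)) mp 1 (D ++ v ∷ I))
    ≡⟨ cong reverse (markFrom-middle D mp refl) ⟩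
  reverse (map u D ++ ⟨ v , mp ⟩ ∷ map u I)
    ≡⟨ reverse-++ (map u D) (⟨ v , mp ⟩ ∷ map u I) ⟩
  reverse (⟨ v , mp ⟩ ∷ map u I) ++ reverse (map u D)
    ≡⟨ cong (_++ reverse (map u D)) (unfold-reverse ⟨ v , mp ⟩ (map u I)) ⟩
  (reverse (map u I) ++ [ ⟨ v , mp ⟩ ]) ++ reverse (map u D)
    ≡⟨ ++-assoc (reverse (map u I)) [ ⟨ v , mp ⟩ ] (reverse (map u D)) ⟩
  reverse (map u I) ++ ⟨ v , mp ⟩ ∷ reverse (map u D)
    ≡⟨ cong₂ (λ A B → A ++ ⟨ v , mp ⟩ ∷ B) (reverse-map-u I) (reverse-map-u D) ⟩
  revUnprimed I ++ ⟨ v , mp ⟩ ∷ revUnprimed D ∎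
  where open ≡-Reasoning

-- Elementary moves in the reading word

~dec-isEquivalence : IsEquivalence _~dec_
~dec-isEquivalence = record { refl = ~refl ; sym = ~sym ; trans = ~trans }

~dec-setoid : Setoid 0ℓ 0ℓ
~dec-setoid = record { isEquivalence = ~dec-isEquivalence }

module ~-Reasoning = SetoidReasoning ~dec-setoid

++⁺ˡ : ∀ P {X Y} → X ~dec Y → P ++ X ~dec P ++ Y
++⁺ˡ P = ~concat (~refl {P})

++⁺ʳ : ∀ R {X Y} → X ~dec Y → X ++ R ~dec Y ++ R
++⁺ʳ R X~Y = ~concat X~Y (~refl {R})

HeadEntry : (ℕ → Set) → Word → Set
HeadEntry P [] = ⊥
HeadEntry P (⟨ a , _ ⟩ ∷ _) = P a

HeadEntry-revUnprimed : ∀ {P} xs W → HeadEntry P W → All P xs → HeadEntry P (revUnprimed xs ++ W)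
HeadEntry-revUnprimed [] W hW _ = hW
HeadEntry-revUnprimed {P} (x ∷ xs) W hW (px ∷ pxs) =
  subst (HeadEntry P) (sym (++-assoc (revUnprimed xs) [ u x ] W)) (HeadEntry-revUnprimed xs (u x ∷ W) px pxs)

unprime-second : ∀ {x s v} mp R → 1 ≤ x → x ≤ v →
                 ⟨ x , s ⟩ ∷ ⟨ v , mp ⟩ ∷ R ~dec ⟨ x , s ⟩ ∷ u v ∷ R
unprime-second false R _ _ = ~refl
unprime-second true R 1≤x x≤v = ++⁺ʳ R (~sym (gen (r1 1≤x x≤v)))

unprime-first : ∀ {x} pr W → HeadEntry (λ e → 1 ≤ e × e < x) W → ⟨ x , pr ⟩ ∷ W ~dec u x ∷ W
unprime-first false W _ = ~refl
unprime-first true (⟨ e , t ⟩ ∷ R) (1≤e , e<x) = ++⁺ʳ R (~sym (gen (r2 1≤e e<x)))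

pass-larger : ∀ I {x s b} W → 1 ≤ x → x ≤ b → HeadEntry (λ e → 1 ≤ e × e < b) W → Linked _<_ (b ∷ I) →
              ⟨ x , s ⟩ ∷ revUnprimed I ++ u b ∷ W ~dec revUnprimed I ++ ⟨ x , s ⟩ ∷ u b ∷ W
pass-larger [] W _ _ _ _ = ~refl
pass-larger (y ∷ I) {x} {s} {b} W@(⟨ e , t ⟩ ∷ R) 1≤x x≤b (1≤e , e<b) (b<y ∷ ys) = begin
  ⟨ x , s ⟩ ∷ (revUnprimed I ++ [ u y ]) ++ u b ∷ W
    ≡⟨ cong (⟨ x , s ⟩ ∷_) (++-assoc (revUnprimed I) [ u y ] (u b ∷ W)) ⟩
  ⟨ x , s ⟩ ∷ revUnprimed I ++ u y ∷ u b ∷ W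
    ≈⟨ pass-larger I (u b ∷ W) 1≤x (≤-trans x≤b (<⇒≤ b<y)) (≤-trans 1≤x x≤b , b<y) ys ⟩
  revUnprimed I ++ ⟨ x , s ⟩ ∷ u y ∷ u b ∷ W
    ≈⟨ ++⁺ˡ (revUnprimed I) (++⁺ʳ R swap) ⟩
  revUnprimed I ++ u y ∷ ⟨ x , s ⟩ ∷ u b ∷ W
    ≡⟨ ++-assoc (revUnprimed I) [ u y ] (⟨ x , s ⟩ ∷ u b ∷ W) ⟨
  (revUnprimed I ++ [ u y ]) ++ ⟨ x , s ⟩ ∷ u b ∷ W ∎
  where
  open ~-Reasoning
  swap : ⟨ x , s ⟩ ∷ u y ∷ u b ∷ ⟨ e , t ⟩ ∷ [] ~dec u y ∷ ⟨ x , s ⟩ ∷ u b ∷ ⟨ e , t ⟩ ∷ []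
  swap with x ≤? e
  ... | yes x≤e = ~sym (gen (r5 1≤x x≤e e<b b<y))
  ... | no x≰e = ~sym (gen (r8 1≤e (≰⇒> x≰e) x≤b b<y))

-- If I is increasing with all entries below x, then lowest x I is the least of
-- x and I, and others x I lists the rest in increasing order.
lowest : ℕ → List ℕ → ℕ
lowest x [] = x
lowest x (h ∷ _) = h

others : ℕ → List ℕ → List ℕ
others x [] = []
others x (_ ∷ I) = I ++ [ x ]

lowest∷others : ∀ x I J → I ++ x ∷ J ≡ lowest x I ∷ others x I ++ J
lowest∷others x [] J = refl
lowest∷others x (h ∷ I) J = cong (h ∷_) (sym (++-assoc I [ x ] J))

revUnprimed-others : ∀ x I → revUnprimed (others x I) ++ [ u (lowest x I) ] ≡ u x ∷ revUnprimed I
revUnprimed-others x [] = refl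
revUnprimed-others x (h ∷ I) = cong (_++ [ u h ]) (revUnprimed-∷ʳ I x)

lowest-All : ∀ {P : ℕ → Set} {x} I → P x → All P I → P (lowest x I)
lowest-All [] px _ = px
lowest-All (_ ∷ _) _ (ph ∷ _) = ph

<-lowest : ∀ {z x} I → z < x → Linked _<_ (z ∷ I) → z < lowest x I
<-lowest [] z<x _ = z<x
<-lowest (_ ∷ _) _ (z<h ∷ _) = z<h

pass-smaller : ∀ I {x σ B g t} R → x ≤ B → 1 ≤ g → Linked _<_ (g ∷ I) → All (_< x) I →
               ⟨ x , σ ⟩ ∷ u B ∷ revUnprimed I ++ ⟨ g , t ⟩ ∷ R
                 ~dec revUnprimed (others x I) ++ ⟨ lowest x I , σ ⟩ ∷ u B ∷ ⟨ g , t ⟩ ∷ R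
pass-smaller [] R _ _ _ _ = ~refl
pass-smaller (z ∷ I) {x} {σ} {B} {g} {t} R x≤B 1≤g (g<z ∷ zs) (z<x ∷ I<x) = begin
  ⟨ x , σ ⟩ ∷ u B ∷ (revUnprimed I ++ [ u z ]) ++ ⟨ g , t ⟩ ∷ R
    ≡⟨ cong (λ W → ⟨ x , σ ⟩ ∷ u B ∷ W) (++-assoc (revUnprimed I) [ u z ] (⟨ g , t ⟩ ∷ R)) ⟩
  ⟨ x , σ ⟩ ∷ u B ∷ revUnprimed I ++ u z ∷ ⟨ g , t ⟩ ∷ R
    ≈⟨ pass-smaller I (⟨ g , t ⟩ ∷ R) x≤B (≤-trans 1≤g (<⇒≤ g<z)) zs I<x ⟩
  revUnprimed (others x I) ++ ⟨ w , σ ⟩ ∷ u B ∷ u z ∷ ⟨ g , t ⟩ ∷ R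
    ≈⟨ ++⁺ˡ (revUnprimed (others x I)) (++⁺ʳ R (~sym (gen (r7 1≤g g<z (<-lowest I z<x zs) w≤B)))) ⟩
  revUnprimed (others x I) ++ u w ∷ ⟨ z , σ ⟩ ∷ u B ∷ ⟨ g , t ⟩ ∷ R
    ≡⟨ ++-assoc (revUnprimed (others x I)) [ u w ] (⟨ z , σ ⟩ ∷ u B ∷ ⟨ g , t ⟩ ∷ R) ⟨
  (revUnprimed (others x I) ++ [ u w ]) ++ ⟨ z , σ ⟩ ∷ u B ∷ ⟨ g , t ⟩ ∷ R
    ≡⟨ cong (_++ ⟨ z , σ ⟩ ∷ u B ∷ ⟨ g , t ⟩ ∷ R)
            (trans (revUnprimed-others x I) (sym (revUnprimed-∷ʳ I x))) ⟩
  revUnprimed (I ++ [ x ]) ++ ⟨ z , σ ⟩ ∷ u B ∷ ⟨ g , t ⟩ ∷ R ∎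
  where
  open ~-Reasoning
  w : ℕ
  w = lowest x I
  w≤B : w ≤ B
  w≤B = lowest-All I x≤B (All.map (λ y<x → ≤-trans (<⇒≤ y<x) x≤B) I<x)

carry-through : ∀ K {y s B f τ c} R → 1 ≤ y → y ≤ f → c < B → Linked _≤_ (f ∷ K ++ [ c ]) →
                ⟨ y , s ⟩ ∷ u B ∷ ⟨ f , τ ⟩ ∷ map u K ++ u c ∷ R
                  ~dec ⟨ y , s ⟩ ∷ u f ∷ map u K ++ u B ∷ ⟨ c , τ ⟩ ∷ R
carry-through [] R 1≤y y≤f c<B (f≤c ∷ _) = ++⁺ʳ R (~sym (gen (r3 1≤y y≤f f≤c c<B)))
carry-through (k ∷ K) {y} {s} {c = c} R 1≤y y≤f c<B (f≤k ∷ ks) =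
  ~trans (++⁺ʳ (map u K ++ u c ∷ R) (~sym (gen (r3 1≤y y≤f f≤k (≤-<-trans (Linked-last ≤-trans K ks) c<B)))))
         (++⁺ˡ [ ⟨ y , s ⟩ ] (carry-through K R (≤-trans 1≤y y≤f) f≤k c<B ks))

swap-valley : ∀ {w σ B e τ g} → 1 ≤ e → e < w → w ≤ B → e ≤ g → g < B →
              ⟨ w , σ ⟩ ∷ u B ∷ ⟨ e , τ ⟩ ∷ u g ∷ []
                ~dec u w ∷ ⟨ e , τ ⟩ ∷ u B ∷ ⟨ g , σ ⟩ ∷ []
swap-valley {w} {g = g} 1≤e e<w w≤B e≤g g<B with w ≤? g
... | yes w≤g = ~sym (gen (r6 1≤e e<w w≤g g<B))
... | no w≰g = ~sym (gen (r10 1≤e e≤g (≰⇒> w≰g) w≤B))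

carry-through-valley : ∀ K {w σ B e τ c} R → 1 ≤ e → e < w → w ≤ B → c < B →
                       Linked _≤_ (e ∷ K ++ [ c ]) →
                       ⟨ w , σ ⟩ ∷ u B ∷ ⟨ e , τ ⟩ ∷ map u K ++ u c ∷ R
                         ~dec u w ∷ ⟨ e , τ ⟩ ∷ map u K ++ u B ∷ ⟨ c , σ ⟩ ∷ R
carry-through-valley [] R 1≤e e<w w≤B c<B (e≤c ∷ _) = ++⁺ʳ R (swap-valley 1≤e e<w w≤B e≤c c<B)
carry-through-valley (k ∷ K) {w} {c = c} R 1≤e e<w w≤B c<B (e≤k ∷ ks) =
  ~trans (++⁺ʳ (map u K ++ u c ∷ R) (swap-valley 1≤e e<w w≤B e≤k (≤-<-trans (Linked-last ≤-trans K ks) c<B)))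
         (++⁺ˡ [ u w ] (carry-through K R 1≤e e≤k c<B ks))

sink-past : ∀ K {y σ z m τ} → 1 ≤ y → 1 ≤ m → y ≤ z → m < z → Linked _≤_ (z ∷ K) →
            ⟨ y , σ ⟩ ∷ u z ∷ ⟨ m , τ ⟩ ∷ map u K
              ~dec ⟨ y , σ ⟩ ∷ u z ∷ map u K ++ [ ⟨ m , τ ⟩ ]
sink-past [] _ _ _ _ _ = ~refl
sink-past (k ∷ K) {y} {σ} {z} {m} {τ} 1≤y 1≤m y≤z m<z (z≤k ∷ ks) =
  ~trans (++⁺ʳ (map u K) swap)
         (++⁺ˡ [ ⟨ y , σ ⟩ ] (sink-past K (≤-trans 1≤y y≤z) 1≤m z≤k (<-≤-trans m<z z≤k) ks))
  where
  swap : ⟨ y , σ ⟩ ∷ u z ∷ ⟨ m , τ ⟩ ∷ u k ∷ []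
         ~dec ⟨ y , σ ⟩ ∷ u z ∷ u k ∷ ⟨ m , τ ⟩ ∷ []
  swap with y ≤? m
  ... | yes y≤m = ~sym (gen (r4 1≤y y≤m m<z z≤k))
  ... | no y≰m = ~sym (gen (r9 1≤m (≰⇒> y≰m) y≤z z≤k))

reverse-between : ∀ (c : ℕ) D f → reverse (c ∷ D ++ [ f ]) ≡ f ∷ reverse D ++ [ c ]
reverse-between c D f = trans (unfold-reverse c (D ++ [ f ])) (cong (_++ [ c ]) (reverse-++ D [ f ]))

Linked-≥-reverse : ∀ c D f → Linked _≥_ (c ∷ D ++ [ f ]) → Linked _≤_ (f ∷ reverse D ++ [ c ])
Linked-≥-reverse c D f ds = subst (Linked _≤_) (reverse-between c D f) (Linked-reverse ≥-trans (c ∷ D ++ [ f ]) ds)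

carry-through-decreasing :
  ∀ D {y s B f τ c} R → 1 ≤ y → y ≤ f → c < B → Linked _≥_ (c ∷ D ++ [ f ]) →
  ⟨ y , s ⟩ ∷ u B ∷ ⟨ f , τ ⟩ ∷ revUnprimed D ++ u c ∷ R
    ~dec ⟨ y , s ⟩ ∷ u f ∷ revUnprimed D ++ u B ∷ ⟨ c , τ ⟩ ∷ R
carry-through-decreasing D {f = f} {c = c} R 1≤y y≤f c<B ds rewrite revUnprimed≡map-reverse D =
  carry-through (reverse D) R 1≤y y≤f c<B (Linked-≥-reverse c D f ds)

carry-through-valley-decreasing :
  ∀ D {w σ B e τ c} R → 1 ≤ e → e < w → w ≤ B → c < B → Linked _≥_ (c ∷ D ++ [ e ]) →
  ⟨ w , σ ⟩ ∷ u B ∷ ⟨ e , τ ⟩ ∷ revUnprimed D ++ u c ∷ R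
    ~dec u w ∷ ⟨ e , τ ⟩ ∷ revUnprimed D ++ u B ∷ ⟨ c , σ ⟩ ∷ R
carry-through-valley-decreasing D {e = e} {c = c} R 1≤e e<w w≤B c<B ds rewrite revUnprimed≡map-reverse D =
  carry-through-valley (reverse D) R 1≤e e<w w≤B c<B (Linked-≥-reverse c D e ds)

data LastEntry (P : ℕ → Set) : Word → Set where
  lastEntry : ∀ W y σ → P y → LastEntry P (W ++ [ ⟨ y , σ ⟩ ])

LastEntry-revUnprimed : ∀ {P} A {v s} D → P v → All P D → LastEntry P (A ++ ⟨ v , s ⟩ ∷ revUnprimed D)
LastEntry-revUnprimed A {v} {s} [] pv _ = lastEntry A v s pv
LastEntry-revUnprimed {P} A {v} {s} (z ∷ D) _ (pz ∷ _) =
  subst (LastEntry P) (++-assoc A (⟨ v , s ⟩ ∷ revUnprimed D) [ u z ])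
        (lastEntry (A ++ ⟨ v , s ⟩ ∷ revUnprimed D) z false pz)

sink-to-end : ∀ {b c τ} D W → LastEntry (λ y → 1 ≤ y × y ≤ b) W → 1 ≤ c → c < b →
              Linked _≥_ D → All (b ≤_) D →
              W ++ u b ∷ ⟨ c , τ ⟩ ∷ revUnprimed D ~dec W ++ u b ∷ revUnprimed D ++ [ ⟨ c , τ ⟩ ]
sink-to-end {b} {c} {τ} D _ (lastEntry Q y σ (1≤y , y≤b)) 1≤c c<b ds b≤D = begin
  (Q ++ [ ⟨ y , σ ⟩ ]) ++ u b ∷ ⟨ c , τ ⟩ ∷ revUnprimed D
    ≡⟨ ++-assoc Q [ ⟨ y , σ ⟩ ] _ ⟩
  Q ++ ⟨ y , σ ⟩ ∷ u b ∷ ⟨ c , τ ⟩ ∷ revUnprimed D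
    ≈⟨ ++⁺ˡ Q sink ⟩
  Q ++ ⟨ y , σ ⟩ ∷ u b ∷ revUnprimed D ++ [ ⟨ c , τ ⟩ ]
    ≡⟨ ++-assoc Q [ ⟨ y , σ ⟩ ] _ ⟨
  (Q ++ [ ⟨ y , σ ⟩ ]) ++ u b ∷ revUnprimed D ++ [ ⟨ c , τ ⟩ ] ∎
  where
  open ~-Reasoning
  sink : ⟨ y , σ ⟩ ∷ u b ∷ ⟨ c , τ ⟩ ∷ revUnprimed D
         ~dec ⟨ y , σ ⟩ ∷ u b ∷ revUnprimed D ++ [ ⟨ c , τ ⟩ ]
  sink rewrite revUnprimed≡map-reverse D =
    sink-past (reverse D) 1≤y 1≤c y≤b c<b
      (Linked-∷⁺ (All-reverse D b≤D) (Linked-reverse ≥-trans D ds))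

-- Computing one row of decomposition insertion

replaceFirst-at : ∀ (q : ℕ → Bool) x xs {y ys} → All (λ z → q z ≡ false) xs → q y ≡ true →
                  replaceFirst q x (xs ++ y ∷ ys) ≡ just (y , xs ++ x ∷ ys)
replaceFirst-at q x [] [] qy rewrite qy = refl
replaceFirst-at q x (z ∷ xs) {y} {ys} (qz ∷ qxs) qy
  rewrite qz with replaceFirst q x (xs ++ y ∷ ys) | replaceFirst-at q x xs {y} {ys} qxs qy
... | _ | refl = refl

bump-≡ : ∀ a row {b inc c dec} →
         replaceFirst (a ≤ᵇ_) a (drop (decLen row) row) ≡ just (b , inc) →
         replaceFirst (_<ᵇ b) b (take (decLen row) row) ≡ just (c , dec) →
         bump a row ≡ just (c , dec ++ inc)
bump-≡ a row e₁ e₂ rewrite e₁ | e₂ = refl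

decInsert-append : ∀ x row mp rs {t} → isHook (row ++ [ val x ]) ≡ true →
                   not (decLen (row ++ [ val x ]) ≡ᵇ decLen row) ≡ t →
                   decInsert x ((row , mp) ∷ rs) ≡ (row ++ [ val x ] , (if t then primed x else mp)) ∷ rs
decInsert-append x row mp rs hook refl rewrite hook = refl

decInsert-bump : ∀ x row mp rs {c row′ t} → isHook (row ++ [ val x ]) ≡ false →
                 bump (val x) row ≡ just (c , row′) → not (decLen row′ ≡ᵇ decLen row) ≡ t →
                 decInsert x ((row , mp) ∷ rs)
                   ≡ (row′ , (if t then primed x else mp)) ∷ decInsert ⟨ c , (if t then mp else primed x) ⟩ rs
decInsert-bump x row mp rs ¬hook bumps refl rewrite ¬hook | bumps = refl

not≡ᵇ-suc : ∀ {m n} → m ≡ suc n → not (m ≡ᵇ n) ≡ true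
not≡ᵇ-suc {n = n} refl rewrite ≡ᵇ-false (1+n≢n {n}) = refl

not≡ᵇ-refl : ∀ {m n} → m ≡ n → not (m ≡ᵇ n) ≡ false
not≡ᵇ-refl {n = n} refl rewrite ≡ᵇ-refl n = refl

data HookRow (row : List ℕ) : Set where
  hookRow : ∀ D v I → row ≡ D ++ v ∷ I → Hook D v I → 1 ≤ v → HookRow row

data InsertionStep (x : Letter) (row : List ℕ) (mp : Bool) (rs : Tableau) : Set where
  appended : ∀ {row′ f} → decInsert x ((row , mp) ∷ rs) ≡ (row′ , f) ∷ rs → HookRow row′ →
             x ∷ revRowLetters (row , mp) ~dec revRowLetters (row′ , f) → InsertionStep x row mp rs
  bumped : ∀ {row′ f c} → decInsert x ((row , mp) ∷ rs) ≡ (row′ , f) ∷ decInsert c rs → HookRow row′ →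
           1 ≤ val c → x ∷ revRowLetters (row , mp) ~dec revRowLetters (row′ , f) ++ [ c ] →
           InsertionStep x row mp rs

length-∷ʳ : ∀ (xs : List ℕ) x → length (xs ++ [ x ]) ≡ suc (length xs)
length-∷ʳ [] x = refl
length-∷ʳ (_ ∷ xs) x = cong suc (length-∷ʳ xs x)

++-∷ʳ-assoc : ∀ (P Q R : Word) z → (P ++ Q ++ R) ++ [ z ] ≡ P ++ Q ++ R ++ [ z ]
++-∷ʳ-assoc P Q R z = trans (++-assoc P (Q ++ R) [ z ]) (cong (P ++_) (++-assoc Q R [ z ]))

Linked-≥-∷ʳ : ∀ xs {v x} → Linked _≥_ (xs ++ [ v ]) → x ≤ v → Linked _≥_ ((xs ++ [ v ]) ++ [ x ])
Linked-≥-∷ʳ xs {v} ds x≤v =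
  Linked-∷ʳ⁺ (xs ++ [ v ]) ds (All.++⁺ (All.map (≤-trans x≤v) (Linked⇒All-∷ʳ ≥-trans xs ds)) (x≤v ∷ []))

Connected-head : ∀ {R : Rel ℕ 0ℓ} {v} xs {y ys} → All (R v) xs → R v y →
                 Connected R (just v) (head (xs ++ y ∷ ys))
Connected-head [] _ r = just r
Connected-head (_ ∷ _) (r ∷ _) _ = just r

append-decreasing : ∀ D {v x} pr mp rs → Hook D v [] → 1 ≤ x → x ≤ v →
                    InsertionStep ⟨ x , pr ⟩ (D ++ [ v ]) mp rs
append-decreasing D {v} {x} pr mp rs h 1≤x x≤v =
  appended (decInsert-append ⟨ x , pr ⟩ (D ++ [ v ]) mp rs hook moved) (hookRow (D ++ [ v ]) x [] refl h′ 1≤x) rel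
  where
  h′ : Hook (D ++ [ v ]) x []
  h′ = record { decreasing = Linked-≥-∷ʳ D (decreasing h) x≤v ; increasing = [-] }
  hook : isHook ((D ++ [ v ]) ++ [ x ]) ≡ true
  hook = isHook-++ (D ++ [ v ]) (decreasing h′) just-nothing
  moved : not (decLen ((D ++ [ v ]) ++ [ x ]) ≡ᵇ decLen (D ++ [ v ])) ≡ true
  moved = not≡ᵇ-suc (trans (decLen-hook h′) (cong suc (trans (length-∷ʳ D v) (sym (decLen-hook h)))))
  rel : ⟨ x , pr ⟩ ∷ revRowLetters (D ++ [ v ] , mp) ~dec revRowLetters ((D ++ [ v ]) ++ [ x ] , pr)
  rel = begin
    ⟨ x , pr ⟩ ∷ revRowLetters (D ++ [ v ] , mp) ≡⟨ cong (⟨ x , pr ⟩ ∷_) (revRowLetters-hook mp h) ⟩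
    ⟨ x , pr ⟩ ∷ ⟨ v , mp ⟩ ∷ revUnprimed D      ≈⟨ unprime-second mp (revUnprimed D) 1≤x x≤v ⟩
    ⟨ x , pr ⟩ ∷ u v ∷ revUnprimed D             ≡⟨ cong (⟨ x , pr ⟩ ∷_) (revUnprimed-∷ʳ D v) ⟨
    ⟨ x , pr ⟩ ∷ revUnprimed (D ++ [ v ])        ≡⟨ revRowLetters-hook pr h′ ⟨
    revRowLetters ((D ++ [ v ]) ++ [ x ] , pr)   ∎
    where open ~-Reasoning

append-increasing : ∀ D {v I x} pr mp rs → Hook D v I → 1 ≤ v → All (_< x) (v ∷ I) →
                    InsertionStep ⟨ x , pr ⟩ (D ++ v ∷ I) mp rs
append-increasing D {v} {I} {x} pr mp rs h 1≤v (v<x ∷ I<x) =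
  appended (decInsert-append ⟨ x , pr ⟩ (D ++ v ∷ I) mp rs hook kept) (hookRow D v (I ++ [ x ]) assoc h′ 1≤v) rel
  where
  assoc : (D ++ v ∷ I) ++ [ x ] ≡ D ++ v ∷ I ++ [ x ]
  assoc = ++-assoc D (v ∷ I) [ x ]
  h′ : Hook D v (I ++ [ x ])
  h′ = record { decreasing = decreasing h ; increasing = Linked-∷ʳ⁺ (v ∷ I) (increasing h) (v<x ∷ I<x) }
  hook : isHook ((D ++ v ∷ I) ++ [ x ]) ≡ true
  hook = trans (cong isHook assoc)
           (trans (isHook-++ D (decreasing h) (Linked.head′ (increasing h′)))
                  (strictInc-true (Linked.tail (increasing h′))))
  kept : not (decLen ((D ++ v ∷ I) ++ [ x ]) ≡ᵇ decLen (D ++ v ∷ I)) ≡ false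
  kept = not≡ᵇ-refl (trans (cong decLen assoc) (trans (decLen-hook h′) (sym (decLen-hook h))))
  I-bounds : All (λ e → 1 ≤ e × e < x) I
  I-bounds = All.zip (All.map (λ v<e → ≤-trans 1≤v (<⇒≤ v<e)) (Linked⇒All-∷ <-trans (increasing h)) , I<x)
  rel : ⟨ x , pr ⟩ ∷ revRowLetters (D ++ v ∷ I , mp) ~dec revRowLetters ((D ++ v ∷ I) ++ [ x ] , mp)
  rel = begin
    ⟨ x , pr ⟩ ∷ revRowLetters (D ++ v ∷ I , mp)
      ≡⟨ cong (⟨ x , pr ⟩ ∷_) (revRowLetters-hook mp h) ⟩
    ⟨ x , pr ⟩ ∷ revUnprimed I ++ ⟨ v , mp ⟩ ∷ revUnprimed D
      ≈⟨ unprime-first pr _ (HeadEntry-revUnprimed I _ (1≤v , v<x) I-bounds) ⟩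
    u x ∷ revUnprimed I ++ ⟨ v , mp ⟩ ∷ revUnprimed D
      ≡⟨ cong (_++ ⟨ v , mp ⟩ ∷ revUnprimed D) (revUnprimed-∷ʳ I x) ⟨
    revUnprimed (I ++ [ x ]) ++ ⟨ v , mp ⟩ ∷ revUnprimed D
      ≡⟨ trans (cong (λ r → revRowLetters (r , mp)) assoc) (revRowLetters-hook mp h′) ⟨
    revRowLetters ((D ++ v ∷ I) ++ [ x ] , mp) ∎
    where open ~-Reasoning

module Bump {D v I₁ b I₂ x} (h : Hook D v (I₁ ++ b ∷ I₂)) (1≤v : 1 ≤ v) (1≤x : 1 ≤ x)
            (I₁<x : All (_< x) I₁) (x≤b : x ≤ b) where

  row : List ℕ
  row = D ++ v ∷ I₁ ++ b ∷ I₂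

  w : ℕ
  w = lowest x I₁

  prefix : Word
  prefix = revUnprimed (others x I₁ ++ I₂)

  v<I : All (v <_) (I₁ ++ b ∷ I₂)
  v<I = Linked⇒All-∷ <-trans (increasing h)

  v<b : v < b
  v<b = All.head (All.++⁻ʳ I₁ v<I)

  v<I₁ : Linked _<_ (v ∷ I₁)
  v<I₁ = Linked-++⁻ˡ (v ∷ I₁) (increasing h)

  b<I₂ : Linked _<_ (b ∷ I₂)
  b<I₂ = Linked-++⁻ʳ I₁ (Linked.tail (increasing h))

  1≤I₁ : All (1 ≤_) I₁
  1≤I₁ = All.map (λ v<z → ≤-trans 1≤v (<⇒≤ v<z)) (All.++⁻ˡ I₁ v<I)

  1≤w : 1 ≤ w
  1≤w = lowest-All I₁ 1≤x 1≤I₁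

  w≤x : w ≤ x
  w≤x = lowest-All I₁ ≤-refl (All.map <⇒≤ I₁<x)

  w≤b : w ≤ b
  w≤b = ≤-trans w≤x x≤b

  D↓ : Linked _≥_ D
  D↓ = Linked-++⁻ˡ D (decreasing h)

  middle : decLen row ≡ suc (length D)
  middle = decLen-hook h

  not-hook : isHook (row ++ [ x ]) ≡ false
  not-hook = trans (cong isHook assoc)
    (trans (isHook-++ D (decreasing h) (Connected-head I₁ (All.++⁻ˡ I₁ v<I) v<b))
           (¬-not (λ inc → <⇒≱ (Linked-last <-trans I₂ (Linked-++⁻ʳ I₁ (strictInc⇒Linked _ inc))) x≤b)))
    where
    assoc : row ++ [ x ] ≡ D ++ v ∷ I₁ ++ b ∷ I₂ ++ [ x ]
    assoc = trans (++-assoc D (v ∷ I₁ ++ b ∷ I₂) [ x ])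
                  (cong (λ L → D ++ v ∷ L) (++-assoc I₁ (b ∷ I₂) [ x ]))

  bump-increasing : replaceFirst (x ≤ᵇ_) x (drop (decLen row) row) ≡ just (b , I₁ ++ x ∷ I₂)
  bump-increasing =
    trans (cong (replaceFirst (x ≤ᵇ_) x)
                (trans (cong (λ n → drop n row) middle) (drop-middle D v (I₁ ++ b ∷ I₂))))
          (replaceFirst-at (x ≤ᵇ_) x I₁ (All.map ≤ᵇ-false I₁<x) (≤ᵇ-true x≤b))

  decreasing-part : take (decLen row) row ≡ D ++ [ v ]
  decreasing-part = trans (cong (λ n → take n row) middle) (take-middle D v (I₁ ++ b ∷ I₂))

  replaced↑ : Linked _<_ (I₁ ++ x ∷ I₂)
  replaced↑ = Linked-replace I₁ (Linked.tail (increasing h)) I₁<x (≤-<-trans x≤b)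

  revUnprimed-replaced : revUnprimed (I₁ ++ x ∷ I₂) ≡ prefix ++ [ u w ]
  revUnprimed-replaced = cong revUnprimed (lowest∷others x I₁ I₂)

  -- x travels left to right through the increasing part, leaving its prime on w.
  reach-b : ∀ pr mp → ⟨ x , pr ⟩ ∷ revRowLetters (row , mp)
                        ~dec prefix ++ ⟨ w , pr ⟩ ∷ u b ∷ ⟨ v , mp ⟩ ∷ revUnprimed D
  reach-b pr mp = begin
    ⟨ x , pr ⟩ ∷ revRowLetters (row , mp)
      ≡⟨ cong (⟨ x , pr ⟩ ∷_) (trans (revRowLetters-hook mp h)
           (trans (cong (_++ V) (revUnprimed-mid I₁ b I₂))
                  (++-assoc (revUnprimed I₂) (u b ∷ revUnprimed I₁) V))) ⟩
    ⟨ x , pr ⟩ ∷ revUnprimed I₂ ++ u b ∷ revUnprimed I₁ ++ V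
      ≈⟨ pass-larger I₂ (revUnprimed I₁ ++ V) 1≤x x≤b
           (HeadEntry-revUnprimed I₁ V (1≤v , v<b) I₁-bounds) b<I₂ ⟩
    revUnprimed I₂ ++ ⟨ x , pr ⟩ ∷ u b ∷ revUnprimed I₁ ++ V
      ≈⟨ ++⁺ˡ (revUnprimed I₂) (pass-smaller I₁ (revUnprimed D) x≤b 1≤v v<I₁ I₁<x) ⟩
    revUnprimed I₂ ++ revUnprimed (others x I₁) ++ ⟨ w , pr ⟩ ∷ u b ∷ V
      ≡⟨ ++-assoc (revUnprimed I₂) (revUnprimed (others x I₁)) (⟨ w , pr ⟩ ∷ u b ∷ V) ⟨
    (revUnprimed I₂ ++ revUnprimed (others x I₁)) ++ ⟨ w , pr ⟩ ∷ u b ∷ V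
      ≡⟨ cong (_++ ⟨ w , pr ⟩ ∷ u b ∷ V) (revUnprimed-++ (others x I₁) I₂) ⟨
    prefix ++ ⟨ w , pr ⟩ ∷ u b ∷ V ∎
    where
    open ~-Reasoning
    V : Word
    V = ⟨ v , mp ⟩ ∷ revUnprimed D
    I₁-bounds : All (λ e → 1 ≤ e × e < b) I₁
    I₁-bounds = All.zip (1≤I₁ , All.map (λ e<x → <-≤-trans e<x x≤b) I₁<x)

bump-middle : ∀ {D v I₁ b I₂ x} pr mp rs → Hook D v (I₁ ++ b ∷ I₂) → 1 ≤ v → 1 ≤ x →
              All (_< x) I₁ → x ≤ b → All (b ≤_) D → InsertionStep ⟨ x , pr ⟩ (D ++ v ∷ I₁ ++ b ∷ I₂) mp rs
bump-middle {D} {v} {I₁} {b} {I₂} {x} pr mp rs h 1≤v 1≤x I₁<x x≤b b≤D =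
  bumped (decInsert-bump ⟨ x , pr ⟩ row mp rs not-hook bumps moved)
         (hookRow (D ++ [ b ]) w (others x I₁ ++ I₂) row′≡ h′ 1≤w) 1≤v rel
  where
  open Bump h 1≤v 1≤x I₁<x x≤b
  row′ : List ℕ
  row′ = (D ++ [ b ]) ++ I₁ ++ x ∷ I₂
  row′≡ : row′ ≡ (D ++ [ b ]) ++ w ∷ others x I₁ ++ I₂
  row′≡ = cong ((D ++ [ b ]) ++_) (lowest∷others x I₁ I₂)
  bumps : bump x row ≡ just (v , row′)
  bumps = bump-≡ x row bump-increasing
    (trans (cong (replaceFirst (_<ᵇ b) b) decreasing-part)
           (replaceFirst-at (_<ᵇ b) b D (All.map <ᵇ-false b≤D) (<ᵇ-true v<b)))
  h′ : Hook (D ++ [ b ]) w (others x I₁ ++ I₂)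
  h′ = record
    { decreasing =
        Linked-≥-∷ʳ D (Linked-replace D (decreasing h) b≤D (λ z≤v → ≤-trans z≤v (<⇒≤ v<b))) w≤b
    ; increasing = subst (Linked _<_) (lowest∷others x I₁ I₂) replaced↑ }
  moved : not (decLen row′ ≡ᵇ decLen row) ≡ true
  moved = not≡ᵇ-suc (trans (cong decLen row′≡)
                            (trans (decLen-hook h′) (cong suc (trans (length-∷ʳ D b) (sym middle)))))
  reading′ : revRowLetters (row′ , pr) ≡ prefix ++ ⟨ w , pr ⟩ ∷ u b ∷ revUnprimed D
  reading′ = trans (cong (λ r → revRowLetters (r , pr)) row′≡)
    (trans (revRowLetters-hook pr h′) (cong (λ W → prefix ++ ⟨ w , pr ⟩ ∷ W) (revUnprimed-∷ʳ D b)))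
  rel : ⟨ x , pr ⟩ ∷ revRowLetters (row , mp) ~dec revRowLetters (row′ , pr) ++ [ ⟨ v , mp ⟩ ]
  rel = begin
    ⟨ x , pr ⟩ ∷ revRowLetters (row , mp)
      ≈⟨ reach-b pr mp ⟩
    prefix ++ ⟨ w , pr ⟩ ∷ u b ∷ ⟨ v , mp ⟩ ∷ revUnprimed D
      ≈⟨ ++⁺ˡ prefix (sink-to-end D [ ⟨ w , pr ⟩ ] (lastEntry [] w pr (1≤w , w≤b)) 1≤v v<b D↓ b≤D) ⟩
    prefix ++ ⟨ w , pr ⟩ ∷ u b ∷ revUnprimed D ++ [ ⟨ v , mp ⟩ ]
      ≡⟨ ++-∷ʳ-assoc prefix (⟨ w , pr ⟩ ∷ u b ∷ []) (revUnprimed D) ⟨ v , mp ⟩ ⟨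
    (prefix ++ ⟨ w , pr ⟩ ∷ u b ∷ revUnprimed D) ++ [ ⟨ v , mp ⟩ ]
      ≡⟨ cong (_++ [ ⟨ v , mp ⟩ ]) reading′ ⟨
    revRowLetters (row′ , pr) ++ [ ⟨ v , mp ⟩ ] ∎
    where open ~-Reasoning

module BumpDecreasing {D₁ c D₂ v I₁ b I₂ x} (h : Hook (D₁ ++ c ∷ D₂) v (I₁ ++ b ∷ I₂))
                      (1≤v : 1 ≤ v) (1≤x : 1 ≤ x) (I₁<x : All (_< x) I₁) (x≤b : x ≤ b)
                      (b≤D₁ : All (b ≤_) D₁) (c<b : c < b) where

  open Bump h 1≤v 1≤x I₁<x x≤b public

  D′ : List ℕ
  D′ = D₁ ++ b ∷ D₂

  row′ : List ℕ
  row′ = (D₁ ++ b ∷ D₂ ++ [ v ]) ++ I₁ ++ x ∷ I₂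

  D≡ : (D₁ ++ c ∷ D₂) ++ [ v ] ≡ D₁ ++ c ∷ D₂ ++ [ v ]
  D≡ = ++-assoc D₁ (c ∷ D₂) [ v ]

  bumps : bump x row ≡ just (c , row′)
  bumps = bump-≡ x row bump-increasing
    (trans (cong (replaceFirst (_<ᵇ b) b) (trans decreasing-part D≡))
           (replaceFirst-at (_<ᵇ b) b D₁ (All.map <ᵇ-false b≤D₁) (<ᵇ-true c<b)))

  old↓ : Linked _≥_ (D₁ ++ c ∷ D₂ ++ [ v ])
  old↓ = subst (Linked _≥_) D≡ (decreasing h)

  c∷D₂v↓ : Linked _≥_ (c ∷ D₂ ++ [ v ])
  c∷D₂v↓ = Linked-++⁻ʳ D₁ old↓

  D₁↓ : Linked _≥_ D₁
  D₁↓ = Linked-++⁻ˡ D₁ old↓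

  new↓ : Linked _≥_ (D′ ++ [ v ])
  new↓ = subst (Linked _≥_) (sym (++-assoc D₁ (b ∷ D₂) [ v ]))
               (Linked-replace D₁ old↓ b≤D₁ (λ z≤c → ≤-trans z≤c (<⇒≤ c<b)))

  D₂v≤c : All (_≤ c) (D₂ ++ [ v ])
  D₂v≤c = Linked⇒All-∷ ≥-trans c∷D₂v↓

  v≤c : v ≤ c
  v≤c = All.head (All.++⁻ʳ D₂ D₂v≤c)

  1≤c : 1 ≤ c
  1≤c = ≤-trans 1≤v v≤c

  bounds : ∀ A {s} → LastEntry (λ y → 1 ≤ y × y ≤ b) (A ++ ⟨ v , s ⟩ ∷ revUnprimed D₂)
  bounds A = LastEntry-revUnprimed A D₂ (1≤v , ≤-trans v≤c (<⇒≤ c<b))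
    (All.zip (All.map (≤-trans 1≤v) (Linked⇒All-∷ʳ ≥-trans D₂ (Linked.tail c∷D₂v↓)) ,
              All.map (λ z≤c → ≤-trans z≤c (<⇒≤ c<b)) (All.++⁻ˡ D₂ D₂v≤c)))

  same-length : length D′ ≡ length (D₁ ++ c ∷ D₂)
  same-length = trans (length-++-sucʳ D₁ b D₂) (sym (length-++-sucʳ D₁ c D₂))

bump-decreasing-new-middle :
  ∀ {D₁ c D₂ v b I₂ x} pr mp rs → Hook (D₁ ++ c ∷ D₂) v (b ∷ I₂) → 1 ≤ v → 1 ≤ x → x ≤ b →
  All (b ≤_) D₁ → c < b → x ≤ v → InsertionStep ⟨ x , pr ⟩ ((D₁ ++ c ∷ D₂) ++ v ∷ b ∷ I₂) mp rs
bump-decreasing-new-middle {D₁} {c} {D₂} {v} {b} {I₂} {x} pr mp rs h 1≤v 1≤x x≤b b≤D₁ c<b x≤v =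
  bumped (decInsert-bump ⟨ x , pr ⟩ row mp rs not-hook bumps moved)
         (hookRow (D₁ ++ b ∷ D₂ ++ [ v ]) x I₂ refl h′ 1≤x) 1≤c rel
  where
  open BumpDecreasing h 1≤v 1≤x [] x≤b b≤D₁ c<b
  h′ : Hook (D₁ ++ b ∷ D₂ ++ [ v ]) x I₂
  h′ = record
    { decreasing =
        subst (λ L → Linked _≥_ (L ++ [ x ])) (++-assoc D₁ (b ∷ D₂) [ v ]) (Linked-≥-∷ʳ D′ new↓ x≤v)
    ; increasing = Linked-replace [] b<I₂ [] (≤-<-trans x≤b) }
  moved : not (decLen row′ ≡ᵇ decLen row) ≡ true
  moved = not≡ᵇ-suc (begin
    decLen row′                          ≡⟨ decLen-hook h′ ⟩
    suc (length (D₁ ++ b ∷ D₂ ++ [ v ])) ≡⟨ cong (suc ∘ length) (++-assoc D₁ (b ∷ D₂) [ v ]) ⟨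
    suc (length (D′ ++ [ v ]))           ≡⟨ cong suc (length-∷ʳ D′ v) ⟩
    suc (suc (length D′))                ≡⟨ cong (suc ∘ suc) same-length ⟩
    suc (suc (length (D₁ ++ c ∷ D₂)))    ≡⟨ cong suc middle ⟨
    suc (decLen row)                     ∎)
    where open ≡-Reasoning
  reading′ : revRowLetters (row′ , pr)
             ≡ revUnprimed I₂ ++ ⟨ x , pr ⟩ ∷ u v ∷ revUnprimed D₂ ++ u b ∷ revUnprimed D₁
  reading′ = trans (revRowLetters-hook pr h′) (cong (λ W → revUnprimed I₂ ++ ⟨ x , pr ⟩ ∷ W)
    (trans (revUnprimed-mid D₁ b (D₂ ++ [ v ])) (cong (_++ u b ∷ revUnprimed D₁) (revUnprimed-∷ʳ D₂ v))))
  rel : ⟨ x , pr ⟩ ∷ revRowLetters (row , mp) ~dec revRowLetters (row′ , pr) ++ [ ⟨ c , mp ⟩ ]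
  rel = begin
    ⟨ x , pr ⟩ ∷ revRowLetters (row , mp)
      ≈⟨ reach-b pr mp ⟩
    revUnprimed I₂ ++ ⟨ x , pr ⟩ ∷ u b ∷ ⟨ v , mp ⟩ ∷ revUnprimed (D₁ ++ c ∷ D₂)
      ≡⟨ cong (λ W → revUnprimed I₂ ++ ⟨ x , pr ⟩ ∷ u b ∷ ⟨ v , mp ⟩ ∷ W) (revUnprimed-mid D₁ c D₂) ⟩
    revUnprimed I₂ ++ ⟨ x , pr ⟩ ∷ u b ∷ ⟨ v , mp ⟩ ∷ revUnprimed D₂ ++ u c ∷ revUnprimed D₁
      ≈⟨ ++⁺ˡ (revUnprimed I₂) (carry-through-decreasing D₂ (revUnprimed D₁) 1≤x x≤v c<b c∷D₂v↓) ⟩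
    revUnprimed I₂ ++ ⟨ x , pr ⟩ ∷ u v ∷ revUnprimed D₂ ++ u b ∷ ⟨ c , mp ⟩ ∷ revUnprimed D₁
      ≈⟨ ++⁺ˡ (revUnprimed I₂) (sink-to-end D₁ _ (bounds [ ⟨ x , pr ⟩ ]) 1≤c c<b D₁↓ b≤D₁) ⟩
    revUnprimed I₂ ++ ⟨ x , pr ⟩ ∷ u v ∷ revUnprimed D₂ ++ u b ∷ revUnprimed D₁ ++ [ ⟨ c , mp ⟩ ]
      ≡⟨ ++-∷ʳ-assoc (revUnprimed I₂) (⟨ x , pr ⟩ ∷ u v ∷ revUnprimed D₂) (u b ∷ revUnprimed D₁) ⟨ c , mp ⟩ ⟨
    (revUnprimed I₂ ++ ⟨ x , pr ⟩ ∷ u v ∷ revUnprimed D₂ ++ u b ∷ revUnprimed D₁) ++ [ ⟨ c , mp ⟩ ]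
      ≡⟨ cong (_++ [ ⟨ c , mp ⟩ ]) reading′ ⟨
    revRowLetters (row′ , pr) ++ [ ⟨ c , mp ⟩ ] ∎
    where open ~-Reasoning

bump-decreasing :
  ∀ {D₁ c D₂ v I₁ b I₂ x} pr mp rs → Hook (D₁ ++ c ∷ D₂) v (I₁ ++ b ∷ I₂) → 1 ≤ v → 1 ≤ x →
  All (_< x) I₁ → x ≤ b → All (b ≤_) D₁ → c < b → v < lowest x I₁ →
  InsertionStep ⟨ x , pr ⟩ ((D₁ ++ c ∷ D₂) ++ v ∷ I₁ ++ b ∷ I₂) mp rs
bump-decreasing {D₁} {c} {D₂} {v} {I₁} {b} {I₂} {x} pr mp rs h 1≤v 1≤x I₁<x x≤b b≤D₁ c<b v<w =
  bumped (decInsert-bump ⟨ x , pr ⟩ row mp rs not-hook bumps kept)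
         (hookRow D′ v (I₁ ++ x ∷ I₂) row′≡ h′ 1≤v) 1≤c rel
  where
  open BumpDecreasing h 1≤v 1≤x I₁<x x≤b b≤D₁ c<b
  row′≡ : row′ ≡ D′ ++ v ∷ I₁ ++ x ∷ I₂
  row′≡ = trans (cong (_++ I₁ ++ x ∷ I₂) (sym (++-assoc D₁ (b ∷ D₂) [ v ])))
                (++-assoc D′ [ v ] (I₁ ++ x ∷ I₂))
  h′ : Hook D′ v (I₁ ++ x ∷ I₂)
  h′ = record
    { decreasing = new↓
    ; increasing = Linked-replace (v ∷ I₁) (increasing h) (<-≤-trans v<w w≤x ∷ I₁<x) (≤-<-trans x≤b) }
  kept : not (decLen row′ ≡ᵇ decLen row) ≡ false
  kept = not≡ᵇ-refl (trans (cong decLen row′≡) (trans (decLen-hook h′) (trans (cong suc same-length) (sym middle))))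
  reading′ : revRowLetters (row′ , mp)
             ≡ prefix ++ u w ∷ ⟨ v , mp ⟩ ∷ revUnprimed D₂ ++ u b ∷ revUnprimed D₁
  reading′ = begin
    revRowLetters (row′ , mp)
      ≡⟨ cong (λ r → revRowLetters (r , mp)) row′≡ ⟩
    revRowLetters (D′ ++ v ∷ I₁ ++ x ∷ I₂ , mp)
      ≡⟨ revRowLetters-hook mp h′ ⟩
    revUnprimed (I₁ ++ x ∷ I₂) ++ ⟨ v , mp ⟩ ∷ revUnprimed D′
      ≡⟨ cong₂ (λ A B → A ++ ⟨ v , mp ⟩ ∷ B) revUnprimed-replaced (revUnprimed-mid D₁ b D₂) ⟩
    (prefix ++ [ u w ]) ++ ⟨ v , mp ⟩ ∷ revUnprimed D₂ ++ u b ∷ revUnprimed D₁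
      ≡⟨ ++-assoc prefix [ u w ] _ ⟩
    prefix ++ u w ∷ ⟨ v , mp ⟩ ∷ revUnprimed D₂ ++ u b ∷ revUnprimed D₁ ∎
    where open ≡-Reasoning
  rel : ⟨ x , pr ⟩ ∷ revRowLetters (row , mp) ~dec revRowLetters (row′ , mp) ++ [ ⟨ c , pr ⟩ ]
  rel = begin
    ⟨ x , pr ⟩ ∷ revRowLetters (row , mp)
      ≈⟨ reach-b pr mp ⟩
    prefix ++ ⟨ w , pr ⟩ ∷ u b ∷ ⟨ v , mp ⟩ ∷ revUnprimed (D₁ ++ c ∷ D₂)
      ≡⟨ cong (λ W → prefix ++ ⟨ w , pr ⟩ ∷ u b ∷ ⟨ v , mp ⟩ ∷ W) (revUnprimed-mid D₁ c D₂) ⟩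
    prefix ++ ⟨ w , pr ⟩ ∷ u b ∷ ⟨ v , mp ⟩ ∷ revUnprimed D₂ ++ u c ∷ revUnprimed D₁
      ≈⟨ ++⁺ˡ prefix (carry-through-valley-decreasing D₂ (revUnprimed D₁) 1≤v v<w w≤b c<b c∷D₂v↓) ⟩
    prefix ++ u w ∷ ⟨ v , mp ⟩ ∷ revUnprimed D₂ ++ u b ∷ ⟨ c , pr ⟩ ∷ revUnprimed D₁
      ≈⟨ ++⁺ˡ prefix (sink-to-end D₁ _ (bounds [ u w ]) 1≤c c<b D₁↓ b≤D₁) ⟩
    prefix ++ u w ∷ ⟨ v , mp ⟩ ∷ revUnprimed D₂ ++ u b ∷ revUnprimed D₁ ++ [ ⟨ c , pr ⟩ ]
      ≡⟨ ++-∷ʳ-assoc prefix (u w ∷ ⟨ v , mp ⟩ ∷ revUnprimed D₂) (u b ∷ revUnprimed D₁) ⟨ c , pr ⟩ ⟨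
    (prefix ++ u w ∷ ⟨ v , mp ⟩ ∷ revUnprimed D₂ ++ u b ∷ revUnprimed D₁) ++ [ ⟨ c , pr ⟩ ]
      ≡⟨ cong (_++ [ ⟨ c , pr ⟩ ]) reading′ ⟨
    revRowLetters (row′ , mp) ++ [ ⟨ c , pr ⟩ ] ∎
    where open ~-Reasoning

data SplitAt≥ (x : ℕ) : List ℕ → Set where
  all< : ∀ {I} → All (_< x) I → SplitAt≥ x I
  at : ∀ I₁ {b} I₂ → All (_< x) I₁ → x ≤ b → SplitAt≥ x (I₁ ++ b ∷ I₂)

splitAt≥ : ∀ x I → SplitAt≥ x I
splitAt≥ x [] = all< []
splitAt≥ x (z ∷ I) with x ≤? z
... | yes x≤z = at [] I [] x≤z
... | no x≰z with splitAt≥ x I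
...   | all< I<x = all< (≰⇒> x≰z ∷ I<x)
...   | at I₁ I₂ I₁<x x≤b = at (z ∷ I₁) I₂ (≰⇒> x≰z ∷ I₁<x) x≤b

data SplitAt< (b : ℕ) : List ℕ → Set where
  all≥ : ∀ {D} → All (b ≤_) D → SplitAt< b D
  at : ∀ D₁ {c} D₂ → All (b ≤_) D₁ → c < b → SplitAt< b (D₁ ++ c ∷ D₂)

splitAt< : ∀ b D → SplitAt< b D
splitAt< b [] = all≥ []
splitAt< b (z ∷ D) with z <? b
... | yes z<b = at [] D [] z<b
... | no z≮b with splitAt< b D
...   | all≥ b≤D = all≥ (≮⇒≥ z≮b ∷ b≤D)
...   | at D₁ D₂ b≤D₁ c<b = at (z ∷ D₁) D₂ (≮⇒≥ z≮b ∷ b≤D₁) c<b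

append : ∀ D {v I x} pr mp rs → Hook D v I → 1 ≤ v → 1 ≤ x → All (_< x) I →
         InsertionStep ⟨ x , pr ⟩ (D ++ v ∷ I) mp rs
append D {v} {[]} {x} pr mp rs h 1≤v 1≤x [] with x ≤? v
... | yes x≤v = append-decreasing D pr mp rs h 1≤x x≤v
... | no x≰v = append-increasing D pr mp rs h 1≤v (≰⇒> x≰v ∷ [])
append D {I = _ ∷ _} pr mp rs h 1≤v _ I<x@(i<x ∷ _) =
  append-increasing D pr mp rs h 1≤v (<-trans (Linked.head (increasing h)) i<x ∷ I<x)

bump-below : ∀ D₁ {c} D₂ {v} I₁ {b I₂ x} pr mp rs → Hook (D₁ ++ c ∷ D₂) v (I₁ ++ b ∷ I₂) →
             1 ≤ v → 1 ≤ x → All (_< x) I₁ → x ≤ b → All (b ≤_) D₁ → c < b →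
             InsertionStep ⟨ x , pr ⟩ ((D₁ ++ c ∷ D₂) ++ v ∷ I₁ ++ b ∷ I₂) mp rs
bump-below D₁ D₂ {v} [] {x = x} pr mp rs h 1≤v 1≤x I₁<x x≤b b≤D₁ c<b with x ≤? v
... | yes x≤v = bump-decreasing-new-middle pr mp rs h 1≤v 1≤x x≤b b≤D₁ c<b x≤v
... | no x≰v = bump-decreasing pr mp rs h 1≤v 1≤x I₁<x x≤b b≤D₁ c<b (≰⇒> x≰v)
bump-below D₁ D₂ (_ ∷ _) pr mp rs h 1≤v 1≤x I₁<x x≤b b≤D₁ c<b =
  bump-decreasing pr mp rs h 1≤v 1≤x I₁<x x≤b b≤D₁ c<b (Linked.head (increasing h))

insert-step : ∀ {row} x pr mp rs → HookRow row → 1 ≤ x → InsertionStep ⟨ x , pr ⟩ row mp rs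
insert-step x pr mp rs (hookRow D v I refl h 1≤v) 1≤x with splitAt≥ x I
... | all< I<x = append D pr mp rs h 1≤v 1≤x I<x
... | at I₁ {b} I₂ I₁<x x≤b with splitAt< b D
...   | all≥ b≤D = bump-middle pr mp rs h 1≤v 1≤x I₁<x x≤b b≤D
...   | at D₁ D₂ b≤D₁ c<b = bump-below D₁ D₂ I₁ pr mp rs h 1≤v 1≤x I₁<x x≤b b≤D₁ c<b

HookTableau : Tableau → Set
HookTableau = All (λ r → HookRow (proj₁ r))

decInsert-~dec : ∀ T → HookTableau T → ∀ x → 1 ≤ val x →
                 (x ∷ revrow T ~dec revrow (decInsert x T)) × HookTableau (decInsert x T)
-- A new row primes its entry by pr ∧ true, which reduces only once pr is known.
decInsert-~dec [] [] ⟨ v , false ⟩ 1≤v = ~refl , hookRow [] v [] refl Hook-singleton 1≤v ∷ []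
decInsert-~dec [] [] ⟨ v , true ⟩ 1≤v = ~refl , hookRow [] v [] refl Hook-singleton 1≤v ∷ []
decInsert-~dec ((row , mp) ∷ rs) (hr ∷ hrs) ⟨ x , pr ⟩ 1≤x with insert-step x pr mp rs hr 1≤x
... | appended eq hr′ rel rewrite eq = ++⁺ʳ (revrow rs) rel , hr′ ∷ hrs
... | bumped {row′} {f} {c} eq hr′ 1≤c rel rewrite eq with decInsert-~dec rs hrs c 1≤c
...   | rel′ , hrs′ = rel″ , hr′ ∷ hrs′
  where
  open ~-Reasoning
  rel″ : ⟨ x , pr ⟩ ∷ revRowLetters (row , mp) ++ revrow rs ~dec revRowLetters (row′ , f) ++ revrow (decInsert c rs)
  rel″ = begin
    ⟨ x , pr ⟩ ∷ revRowLetters (row , mp) ++ revrow rs      ≈⟨ ++⁺ʳ (revrow rs) rel ⟩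
    (revRowLetters (row′ , f) ++ [ c ]) ++ revrow rs        ≡⟨ ++-assoc _ [ c ] (revrow rs) ⟩
    revRowLetters (row′ , f) ++ c ∷ revrow rs               ≈⟨ ++⁺ˡ (revRowLetters (row′ , f)) rel′ ⟩
    revRowLetters (row′ , f) ++ revrow (decInsert c rs)     ∎

Pdec-~dec : ∀ w → All (λ x → 1 ≤ val x) w → (w ~dec revrow (Pdec w)) × HookTableau (Pdec w)
Pdec-~dec [] [] = ~refl , []
Pdec-~dec (x ∷ w) (1≤x ∷ 1≤w) =
  let w~ , hooks = Pdec-~dec w 1≤w
      x∷w~ , hooks′ = decInsert-~dec (Pdec w) hooks x 1≤x
  in ~trans (++⁺ˡ [ x ] w~) x∷w~ , hooks′

mainTheorem9 : (w : Word) → All (λ x → 1 ≤ val x) w → w ~dec revrow (Pdec w)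
mainTheorem9 w 1≤w = proj₁ (Pdec-~dec w 1≤w)
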